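{- Let $A_1$ and $A_2$ be non-ground, simple and covering atoms, each containing a compound term. If $A_1$ and $A_2$ have a most general unifier, then their compound terms occur at matching argument positions: for every argument position, the argument of $A_1$ at that position is a compound term if and only if the argument of $A_2$ at that position is a compound term.
   Context: A compound term is a term that is neither a variable nor a constant. An atom is simple if each argument is a variable, a constant, or a compound term $f(u_1,\dots,u_n)$ with each $u_i$ a variable or a constant. An atom $L$ is covering if every compound term $t$ in $L$ satisfies $\mathrm{Var}(t)=\mathrm{Var}(L)$, where $\mathrm{Var}(E)$ is the set of variables of $E$. Term $t$ in $A_1$ matches term $u$ in $A_2$ if they occupy the same argument position. -}

module Defs where

open import Level using (0ℓ)
open import Data.Nat using (ℕ; zero; suc; _≤_)
open import Data.Vec using (Vec; []; _∷_)
open import Data.Vec.Relation.Unary.Any using (Any)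
open import Data.Vec.Relation.Unary.All using (All)
open import Data.Maybe using (Maybe; just; nothing)
open import Data.Product using (Σ; ∃; _×_)
open import Data.Sum using (_⊎_)
open import Data.Empty using (⊥)
open import Data.Unit using (⊤)
open import Function.Bundles using (_⇔_)
open import Relation.Binary.PropositionalEquality using (_≡_)

-- A first-order signature: variables, function symbols (constants are the
-- function symbols of arity 0) and predicate symbols, each with an arity.
record Signature : Set₁ where
  field
    Var    : Set
    Fun    : Set
    arity  : Fun → ℕ
    Pred   : Set
    parity : Pred → ℕ

module FOL (S : Signature) where
  open Signature S

  data Term : Set where
    var : Var → Term
    fn  : (f : Fun) → Vec Term (arity f) → Term

  record Atom : Set where
    constructor atom
    field
      pred : Pred
      args : Vec Term (parity pred)
  open Atom public

  IsVar : Term → Set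
  IsVar (var _)  = ⊤
  IsVar (fn _ _) = ⊥

  IsConst : Term → Set
  IsConst (var _)  = ⊥
  IsConst (fn f _) = arity f ≡ 0

  IsCompound : Term → Set
  IsCompound (var _)  = ⊥
  IsCompound (fn f _) = 1 ≤ arity f

  data _⊑_ (s : Term) : Term → Set where
    here  : s ⊑ s
    there : ∀ {f ts} → Any (s ⊑_) ts → s ⊑ fn f ts

  _∈A_ : Term → Atom → Set
  t ∈A A = Any (t ⊑_) (args A)

  _∈VarT_ : Var → Term → Set
  x ∈VarT t = var x ⊑ t

  _∈VarA_ : Var → Atom → Set
  x ∈VarA A = var x ∈A A

  NonGround : Atom → Set
  NonGround A = ∃ λ x → x ∈VarA A

  VarOrConst : Term → Set
  VarOrConst t = IsVar t ⊎ IsConst t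

  SimpleArg : Term → Set
  SimpleArg (var _)   = ⊤
  SimpleArg (fn f ts) = All VarOrConst ts

  Simple : Atom → Set
  Simple A = All SimpleArg (args A)

  Covering : Atom → Set
  Covering A = ∀ t → t ∈A A → IsCompound t → ∀ x → (x ∈VarT t ⇔ x ∈VarA A)

  ContainsCompound : Atom → Set
  ContainsCompound A = ∃ λ t → t ∈A A × IsCompound t

  Subst : Set
  Subst = Var → Term

  mutual
    _·_ : Subst → Term → Term
    σ · var x    = σ x
    σ · fn f ts  = fn f (σ ·ᵛ ts)

    _·ᵛ_ : ∀ {n} → Subst → Vec Term n → Vec Term n
    σ ·ᵛ []       = []
    σ ·ᵛ (t ∷ ts) = (σ · t) ∷ (σ ·ᵛ ts)

  _·A_ : Subst → Atom → Atom
  σ ·A atom p ts = atom p (σ ·ᵛ ts)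

  IsUnifier : Subst → Atom → Atom → Set
  IsUnifier σ A₁ A₂ = σ ·A A₁ ≡ σ ·A A₂

  IsMGU : Subst → Atom → Atom → Set
  IsMGU σ A₁ A₂ = IsUnifier σ A₁ A₂ ×
    (∀ θ → IsUnifier θ A₁ A₂ → ∃ λ (δ : Subst) → ∀ x → θ x ≡ δ · σ x)

  -- argument at position i (0-based); nothing if i ≥ arity
  vecAt : ∀ {n} → Vec Term n → ℕ → Maybe Term
  vecAt []       _       = nothing
  vecAt (t ∷ ts) zero    = just t
  vecAt (t ∷ ts) (suc i) = vecAt ts i

  argAt : Atom → ℕ → Maybe Term
  argAt A i = vecAt (args A) i

  CompoundAt : Atom → ℕ → Set
  CompoundAt A i = ∃ λ t → argAt A i ≡ just t × IsCompound t

module Submission where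

-- Suppose A₁ has a compound argument c at position i and σ unifies A₁ and A₂.
-- The argument of A₂ at position i exists (the unified atoms agree there); if it
-- is a function term, σ forces its head symbol to be the one of c, so it is
-- compound as well.  The only real case is a variable z, where σ z = σ c.
--
-- That case is refuted by a size argument.  Because A₁ is simple and covering,
-- every term occurring *properly* below an argument of σA₁ is smaller than σ c
-- (lemma `proper-occurrences-are-small`): it lies inside σ v for a variable v of
-- A₁, which covering puts strictly inside c, or inside an instantiated constant.
-- On the other hand A₂ contains a compound term d, covering puts z strictly
-- inside d, so σ z occurs properly below σ d, an argument-subterm of σA₂ = σA₁.
-- Hence size (σ z) < size (σ c) = size (σ z).

open import Defs
open import Data.Nat using (ℕ; zero; suc; _≤_; _<_; _+_; z≤n; s≤s)
open import Data.Nat.Properties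
  using (≤-refl; ≤-trans; ≤-<-trans; <-trans; <-irrefl; m≤m+n; m≤n+m; m≤n⇒m≤1+n)
open import Data.Product using (∃; _,_)
open import Data.Sum using (inj₁; inj₂)
open import Data.Empty using (⊥; ⊥-elim)
open import Data.Maybe using (just; nothing)
import Data.Maybe as Maybe
open import Data.Maybe.Properties using (just-injective)
open import Data.Vec using (Vec; []; _∷_)
open import Data.Vec.Relation.Unary.Any using (Any; here; there)
import Data.Vec.Relation.Unary.Any as Any
open import Data.Vec.Relation.Unary.All using (lookupAny)
open import Function.Bundles using (_⇔_; mk⇔; Equivalence)
open import Relation.Binary.PropositionalEquality
  using (_≡_; _≢_; refl; sym; cong; subst; module ≡-Reasoning)

module MatchingCompounds (S : Signature) where
  open Signature S
  open FOL S

  _⊏_ : Term → Term → Set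
  s ⊏ var _    = ⊥
  s ⊏ fn f ts  = Any (s ⊑_) ts

  ⊏⇒⊑ : ∀ {s t} → s ⊏ t → s ⊑ t
  ⊏⇒⊑ {t = fn f ts} p = there p

  var-⊏-fn : ∀ {x f ts} → var x ⊑ fn f ts → var x ⊏ fn f ts
  var-⊏-fn (there p) = p

  mutual
    ⊑-trans : ∀ {a b c} → a ⊑ b → b ⊑ c → a ⊑ c
    ⊑-trans p here      = p
    ⊑-trans p (there q) = there (⊑-any-trans p q)

    ⊑-any-trans : ∀ {a b n} {cs : Vec Term n} → a ⊑ b → Any (b ⊑_) cs → Any (a ⊑_) cs
    ⊑-any-trans p (here q)  = here (⊑-trans p q)
    ⊑-any-trans p (there q) = there (⊑-any-trans p q)

  ⊏-⊑-trans : ∀ {a b c} → a ⊏ b → b ⊑ c → a ⊏ c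
  ⊏-⊑-trans p here      = p
  ⊏-⊑-trans p (there q) = ⊑-any-trans (⊏⇒⊑ p) q

  mutual
    ⊑-sub : ∀ σ {s t} → s ⊑ t → (σ · s) ⊑ (σ · t)
    ⊑-sub σ here      = here
    ⊑-sub σ (there p) = there (any-sub σ p)

    any-sub : ∀ σ {s n} {ts : Vec Term n} → Any (s ⊑_) ts → Any ((σ · s) ⊑_) (σ ·ᵛ ts)
    any-sub σ (here p)  = here (⊑-sub σ p)
    any-sub σ (there p) = there (any-sub σ p)

  ⊏-sub : ∀ σ {s t} → s ⊏ t → (σ · s) ⊏ (σ · t)
  ⊏-sub σ {t = fn f ts} p = any-sub σ p

  ∈A-sub : ∀ σ {s} A → s ∈A A → (σ · s) ∈A (σ ·A A)
  ∈A-sub σ A = any-sub σ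

  any-unsub : ∀ σ {P : Term → Set} {n} (ts : Vec Term n) →
              Any P (σ ·ᵛ ts) → Any (λ t → P (σ · t)) ts
  any-unsub σ (t ∷ ts) (here p)  = here p
  any-unsub σ (t ∷ ts) (there p) = there (any-unsub σ ts p)

  lookup-occurs : ∀ {P : Term → Set} {n} {ts : Vec Term n} (p : Any P ts) →
                  Any (Any.lookup p ⊑_) ts
  lookup-occurs (here _)  = here here
  lookup-occurs (there p) = there (lookup-occurs p)

  covered-var-⊏ : ∀ {A c x} → Covering A → c ∈A A → IsCompound c → x ∈VarA A → var x ⊏ c
  covered-var-⊏ {c = fn f ts} {x} cov c∈A c-comp x∈A =
    var-⊏-fn (Equivalence.from (cov (fn f ts) c∈A c-comp x) x∈A)

  mutual
    size : Term → ℕ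
    size (var _)   = 1
    size (fn f ts) = suc (sizes ts)

    sizes : ∀ {n} → Vec Term n → ℕ
    sizes []       = 0
    sizes (t ∷ ts) = size t + sizes ts

  mutual
    ⊑-size : ∀ {s t} → s ⊑ t → size s ≤ size t
    ⊑-size here      = ≤-refl
    ⊑-size (there p) = m≤n⇒m≤1+n (any-size p)

    any-size : ∀ {s n} {ts : Vec Term n} → Any (s ⊑_) ts → size s ≤ sizes ts
    any-size {ts = t ∷ ts} (here p)  = ≤-trans (⊑-size p) (m≤m+n (size t) (sizes ts))
    any-size {ts = t ∷ ts} (there p) = ≤-trans (any-size p) (m≤n+m (sizes ts) (size t))

  ⊏-size : ∀ {s t} → s ⊏ t → size s < size t
  ⊏-size {t = fn f ts} p = s≤s (any-size p)

  size-pos : ∀ t → 1 ≤ size t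
  size-pos (var _)  = s≤s z≤n
  size-pos (fn _ _) = s≤s z≤n

  sizes-pos : ∀ {n} (ts : Vec Term n) → 1 ≤ n → 1 ≤ sizes ts
  sizes-pos (t ∷ ts) _ = ≤-trans (size-pos t) (m≤m+n (size t) (sizes ts))

  sizes-empty : ∀ {n} (ts : Vec Term n) → n ≡ 0 → sizes ts ≡ 0
  sizes-empty [] refl = refl

  const-size : ∀ σ w → IsConst w → size (σ · w) ≡ 1
  const-size σ (fn g ws) g-nullary = cong suc (sizes-empty (σ ·ᵛ ws) g-nullary)

  compound-size : ∀ σ c → IsCompound c → 2 ≤ size (σ · c)
  compound-size σ (fn f ts) f-pos = s≤s (sizes-pos (σ ·ᵛ ts) f-pos)

  module _ {A c} (cov : Covering A) (c∈A : c ∈A A) (c-comp : IsCompound c) (σ : Subst) where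

    instance-smaller : ∀ w → VarOrConst w → w ∈A A → size (σ · w) < size (σ · c)
    instance-smaller (var x) _ x∈A =
      ⊏-size (⊏-sub σ (covered-var-⊏ cov c∈A c-comp x∈A))
    instance-smaller w@(fn _ _) (inj₂ w-const) _ =
      subst (_< size (σ · c)) (sym (const-size σ w w-const)) (compound-size σ c c-comp)

    -- Below the root of an instantiated simple argument r of A, all terms are
    -- smaller than σ c: they sit inside σ w for a variable or constant w of A.
    below-simple-arg : ∀ r → SimpleArg r → r ∈A A →
                       ∀ {t} → t ⊏ (σ · r) → size t < size (σ · c)
    below-simple-arg (var x) _ r∈A t⊏σx =
      <-trans (⊏-size t⊏σx) (instance-smaller (var x) (inj₁ _) r∈A)
    below-simple-arg (fn h ws) ws-simple r∈A t⊏σr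
      with t-in-ws ← any-unsub σ ws t⊏σr
      with (w-simple , t⊑σw) ← lookupAny ws-simple t-in-ws =
      ≤-<-trans (⊑-size t⊑σw) (instance-smaller _ w-simple w∈A)
      where
        w∈A : Any.lookup t-in-ws ∈A A
        w∈A = ⊑-any-trans (there (lookup-occurs t-in-ws)) r∈A

  proper-occurrences-are-small :
    ∀ {A c} → Simple A → Covering A → c ∈A A → IsCompound c →
    ∀ σ {s t} → s ∈A (σ ·A A) → t ⊏ s → size t < size (σ · c)
  proper-occurrences-are-small {A} simple cov c∈A c-comp σ s∈σA t⊏s
    with s-in-args ← any-unsub σ (args A) s∈σA
    with (r-simple , s⊑σr) ← lookupAny simple s-in-args =
    below-simple-arg cov c∈A c-comp σ _ r-simple (lookup-occurs s-in-args)
      (⊏-⊑-trans t⊏s s⊑σr)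

  variable-vs-compound :
    ∀ {A₁ A₂ c z} → Simple A₁ → Covering A₁ → c ∈A A₁ → IsCompound c →
    Covering A₂ → ContainsCompound A₂ → z ∈VarA A₂ →
    ∀ σ → IsUnifier σ A₁ A₂ → σ · c ≢ σ z
  variable-vs-compound {A₁} {A₂} {c} {z} simple₁ cov₁ c∈A₁ c-comp
                       cov₂ (d , d∈A₂ , d-comp) z∈A₂ σ σ-unifies σc≡σz =
    <-irrefl (cong size (sym σc≡σz)) σz<σc
    where
      σz⊏σd : σ z ⊏ (σ · d)
      σz⊏σd = ⊏-sub σ (covered-var-⊏ cov₂ d∈A₂ d-comp z∈A₂)

      σd∈σA₁ : (σ · d) ∈A (σ ·A A₁)
      σd∈σA₁ = subst ((σ · d) ∈A_) (sym σ-unifies) (∈A-sub σ A₂ d∈A₂)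

      σz<σc : size (σ z) < size (σ · c)
      σz<σc = proper-occurrences-are-small simple₁ cov₁ c∈A₁ c-comp σ σd∈σA₁ σz⊏σd

  vecAt-sub : ∀ σ {n} (ts : Vec Term n) i →
              vecAt (σ ·ᵛ ts) i ≡ Maybe.map (σ ·_) (vecAt ts i)
  vecAt-sub σ []       i       = refl
  vecAt-sub σ (t ∷ ts) zero    = refl
  vecAt-sub σ (t ∷ ts) (suc i) = vecAt-sub σ ts i

  vecAt-occurs : ∀ {n} (ts : Vec Term n) i {t} → vecAt ts i ≡ just t → Any (t ⊑_) ts
  vecAt-occurs (t ∷ ts) zero    refl  = here here
  vecAt-occurs (t ∷ ts) (suc i) t-at = there (vecAt-occurs ts i t-at)

  unifier-agrees-at : ∀ {σ A₁ A₂} → IsUnifier σ A₁ A₂ → ∀ i →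
                      Maybe.map (σ ·_) (argAt A₁ i) ≡ Maybe.map (σ ·_) (argAt A₂ i)
  unifier-agrees-at {σ} {A₁} {A₂} σ-unifies i = begin
    Maybe.map (σ ·_) (argAt A₁ i)  ≡⟨ vecAt-sub σ (args A₁) i ⟨
    argAt (σ ·A A₁) i              ≡⟨ cong (λ A → argAt A i) σ-unifies ⟩
    argAt (σ ·A A₂) i              ≡⟨ vecAt-sub σ (args A₂) i ⟩
    Maybe.map (σ ·_) (argAt A₂ i)  ∎
    where open ≡-Reasoning

  fn-head : ∀ {f g} {ts : Vec Term (arity f)} {us : Vec Term (arity g)} →
            fn f ts ≡ fn g us → f ≡ g
  fn-head refl = refl

  compound-position-transfers :
    ∀ {A₁ A₂} → Simple A₁ → Covering A₁ → Covering A₂ → ContainsCompound A₂ →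
    ∀ σ → IsUnifier σ A₁ A₂ → ∀ i → CompoundAt A₁ i → CompoundAt A₂ i
  compound-position-transfers _ _ _ _ _ _ _ (var _ , _ , ())
  compound-position-transfers {A₁} {A₂} simple₁ cov₁ cov₂ compound₂ σ σ-unifies i
                              (c@(fn f ts) , c-at-i , f-pos) =
    by-cases (argAt A₂ i) refl
      (subst (λ m → Maybe.map (σ ·_) m ≡ Maybe.map (σ ·_) (argAt A₂ i))
             c-at-i (unifier-agrees-at σ-unifies i))
    where
      c∈A₁ : c ∈A A₁
      c∈A₁ = vecAt-occurs (args A₁) i c-at-i

      by-cases : ∀ m → argAt A₂ i ≡ m → just (σ · c) ≡ Maybe.map (σ ·_) m → CompoundAt A₂ i
      by-cases nothing _ ()
      by-cases (just (var z)) z-at-i σc≡σz =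
        ⊥-elim (variable-vs-compound simple₁ cov₁ c∈A₁ f-pos cov₂ compound₂
                  (vecAt-occurs (args A₂) i z-at-i) σ σ-unifies (just-injective σc≡σz))
      by-cases (just d@(fn g us)) d-at-i σc≡σd =
        d , d-at-i , subst (λ h → 1 ≤ arity h) (fn-head (just-injective σc≡σd)) f-pos

mainTheorem6 : (S : Signature) → (A₁ A₂ : FOL.Atom S) →
    FOL.NonGround S A₁ → FOL.Simple S A₁ → FOL.Covering S A₁ → FOL.ContainsCompound S A₁ →
    FOL.NonGround S A₂ → FOL.Simple S A₂ → FOL.Covering S A₂ → FOL.ContainsCompound S A₂ →
    (∃ λ σ → FOL.IsMGU S σ A₁ A₂) →
    (i : ℕ) → (FOL.CompoundAt S A₁ i ⇔ FOL.CompoundAt S A₂ i)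
mainTheorem6 S A₁ A₂ _ simple₁ cov₁ compound₁ _ simple₂ cov₂ compound₂
             (σ , σ-unifies , _) i =
  mk⇔ (compound-position-transfers simple₁ cov₁ cov₂ compound₂ σ σ-unifies i)
      (compound-position-transfers simple₂ cov₂ cov₁ compound₁ σ (sym σ-unifies) i)
  where open MatchingCompounds S
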